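{- Let $(a_n)_{n\ge 0}$, $(b_n)_{n\ge 0}$, $(c_n)_{n\ge 0}$ be sequences of complex numbers with $b_0=1$, $a_n\ne 0$ and $c_n\ne 0$ for all $n\ge 0$. Let $\mathscr{A}$ be the infinite lower triangular matrix with entries $\mathscr{A}_{n,k}=a_kb_{n-k}c_n$ for $n\ge k\ge 0$ (and $0$ for $k>n$). Then for every integer $j\ge 1$, the matrix $\mathscr{A}_{[j]}$ belongs to $SDR_\infty$.
   Context: All matrices are infinite lower triangular matrices $\mathscr{A}=(A_{n,k})_{n\ge k\ge 0}$ with complex entries; we set $A_{n,k}=0$ whenever $k>n$. For an integer $m\ge 3$, $\mathscr{A}$ is called an SDR-matrix of order $m$ (written $\mathscr{A}\in SDR_m$) if for all integers $n,k\ge 0$, all $2\le p\le m-1$ and all $0\le r\le p-1$, $$\prod_{i=0}^{r}A_{n+i,k+r-i}\prod_{i=0}^{p-r-1}A_{n+p-i,k+r+i+1}=\prod_{i=0}^{r}A_{n+p-i,k+p-r+i}\prod_{i=0}^{p-r-1}A_{n+i,k+p-r-i-1}.$$ $SDR_\infty$ denotes the set of matrices lying in $SDR_m$ for every $m\ge 3$. For an integer $j\ge 1$, $\mathscr{A}_{[j]}=(A^{[j]}_{n,k})_{n\ge k\ge 0}$ is the lower triangular matrix with $A^{[j]}_{n,k}=\det\big(A_{n+s,k+t}\big)_{0\le s,t\le j-1}$ for $n\ge k\ge 0$ (the $j\times j$ determinant of the block with rows $n,\dots,n+j-1$ and columns $k,\dots,k+j-1$, using $A_{n,k}=0$ for $k>n$).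 -}

module Defs where

open import Level using (Level)
open import Algebra.Bundles using (CommutativeRing)
open import Data.Nat using (ℕ; zero; suc; _+_; _∸_; _≤_; _≤?_)
open import Data.Fin using (Fin; toℕ; punchIn)
import Data.Fin as Fin
open import Relation.Nullary using (yes; no)

module _ {c ℓ : Level} (R : CommutativeRing c ℓ) where
  open CommutativeRing R renaming (_+_ to _+R_; _*_ to _*R_)

  prodUpTo : ℕ → (ℕ → Carrier) → Carrier
  prodUpTo zero    f = 1#
  prodUpTo (suc n) f = prodUpTo n f *R f n

  sumFin : (n : ℕ) → (Fin n → Carrier) → Carrier
  sumFin zero    f = 0#
  sumFin (suc n) f = f Fin.zero +R sumFin n (λ i → f (Fin.suc i))

  signPow : ℕ → Carrier
  signPow zero    = 1#
  signPow (suc t) = - signPow t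

  det : (n : ℕ) → (Fin n → Fin n → Carrier) → Carrier
  det zero    M = 1#
  det (suc n) M = sumFin (suc n) λ t →
    signPow (toℕ t) *R (M Fin.zero t *R det n (λ s u → M (Fin.suc s) (punchIn t u)))

  -- infinite lower-triangular matrices are represented by ℕ → ℕ → Carrier
  -- (the matrices below are defined to be 0 for k > n)
  Matrix : Set c
  Matrix = ℕ → ℕ → Carrier

  SDR : ℕ → Matrix → Set ℓ
  SDR m A = ∀ n k p r → 2 ≤ p → p ≤ m ∸ 1 → r ≤ p ∸ 1 →
    prodUpTo (suc r) (λ i → A (n + i) (k + (r ∸ i)))
      *R prodUpTo (p ∸ r) (λ i → A (n + (p ∸ i)) (k + r + i + 1))
    ≈ prodUpTo (suc r) (λ i → A (n + (p ∸ i)) (k + (p ∸ r) + i))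
      *R prodUpTo (p ∸ r) (λ i → A (n + i) (k + (p ∸ r ∸ i ∸ 1)))

  SDR∞ : Matrix → Set ℓ
  SDR∞ A = ∀ m → 3 ≤ m → SDR m A

  compound : ℕ → Matrix → Matrix
  compound j A n k with k ≤? n
  ... | yes _ = det j (λ s t → A (n + toℕ s) (k + toℕ t))
  ... | no  _ = 0#

  abcMatrix : (ℕ → Carrier) → (ℕ → Carrier) → (ℕ → Carrier) → Matrix
  abcMatrix a b cc n k with k ≤? n
  ... | yes _ = a k *R b (n ∸ k) *R cc n
  ... | no  _ = 0#

-- The matrix (a_k b_{n-k} c_n) is diag(c) · T · diag(a) with T the lower Toeplitz
-- matrix of b.  Taking j × j minors preserves both features: a minor of a
-- diagonally rescaled matrix is the minor of the original times products of the
-- scaling factors, and the minors of a Toeplitz matrix again form a Toeplitz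
-- matrix.  Finally every rescaled Toeplitz matrix satisfies all SDR identities:
-- on each side, the row indices and the column indices each run exactly once
-- through a block of p + 1 consecutive integers, and the Toeplitz factors of the
-- two sides coincide after reversing the order and shifting along the diagonal.
module Submission where

open import Level using (Level)
open import Algebra.Bundles using (CommutativeRing)
open import Data.Nat using (ℕ; zero; suc; _+_; _∸_; _≤_; _<_; _≤?_)
import Data.Nat.Properties as ℕ
open import Data.Nat.Tactic.RingSolver using (solve-∀)
open import Data.Fin using (Fin; toℕ; punchIn)
import Data.Fin as Fin
open import Data.Product using (_,_)
open import Data.Empty using (⊥-elim)
open import Relation.Nullary using (¬_; yes; no)
open import Relation.Binary.PropositionalEquality as ≡ using (_≡_)
open import Defs

[1+m]∸n∸1≡m∸n : ∀ m n → suc m ∸ n ∸ 1 ≡ m ∸ n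
[1+m]∸n∸1≡m∸n m n = ≡.trans (ℕ.∸-+-assoc (suc m) n 1) (≡.cong (suc m ∸_) (ℕ.+-comm n 1))

[1+m+n]∸o≡1+n+[m∸o] : ∀ m n {o} → o ≤ m → suc (m + n) ∸ o ≡ suc n + (m ∸ o)
[1+m+n]∸o≡1+n+[m∸o] m n {o} o≤m =
  ≡.trans (≡.cong (λ x → suc x ∸ o) (ℕ.+-comm m n)) (ℕ.+-∸-assoc (suc n) o≤m)

[1+m+n]∸m≡1+n : ∀ m n → suc (m + n) ∸ m ≡ suc n
[1+m+n]∸m≡1+n m n = ≡.trans ([1+m+n]∸o≡1+n+[m∸o] m n ℕ.≤-refl)
  (≡.trans (≡.cong (suc n +_) (ℕ.n∸n≡0 m)) (ℕ.+-identityʳ (suc n)))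

[1+m+n]∸[m∸o]≡1+n+o : ∀ m n {o} → o ≤ m → suc (m + n) ∸ (m ∸ o) ≡ suc n + o
[1+m+n]∸[m∸o]≡1+n+o m n {o} o≤m =
  ≡.trans ([1+m+n]∸o≡1+n+[m∸o] m n (ℕ.m∸n≤m m o)) (≡.cong (suc n +_) (ℕ.m∸[m∸n]≡n o≤m))

[1+m+n]∸[n∸o]≡1+m+o : ∀ m n {o} → o ≤ n → suc (m + n) ∸ (n ∸ o) ≡ suc m + o
[1+m+n]∸[n∸o]≡1+m+o m n {o} o≤n =
  ≡.trans (ℕ.+-∸-assoc (suc m) (ℕ.m∸n≤m n o)) (≡.cong (suc m +_) (ℕ.m∸[m∸n]≡n o≤n))

module _ {c ℓ : Level} (R : CommutativeRing c ℓ) where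
  open CommutativeRing R hiding (_+_)
  open import Algebra.Properties.CommutativeSemigroup *-commutativeSemigroup
    using (interchange; xy∙z≈zx∙y)
  open import Algebra.Properties.CommutativeMonoid.Sum *-commutativeMonoid
    using () renaming (sum to prodFin; sum-remove to prodFin-remove)
  open import Algebra.Solver.CommutativeMonoid *-commutativeMonoid using (solve; _⊕_; _⊜_)
  open import Relation.Binary.Reasoning.Setoid setoid

  Π : ℕ → (ℕ → Carrier) → Carrier
  Π = prodUpTo R

  Π-cong : ∀ m {f g : ℕ → Carrier} → (∀ i → i < m → f i ≈ g i) → Π m f ≈ Π m g
  Π-cong zero    f≈g = refl
  Π-cong (suc m) f≈g = *-cong (Π-cong m (λ i i<m → f≈g i (ℕ.m<n⇒m<1+n i<m))) (f≈g m ℕ.≤-refl)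

  Π-head : ∀ m f → Π (suc m) f ≈ f 0 * Π m (λ i → f (suc i))
  Π-head zero    f = *-comm _ _
  Π-head (suc m) f = trans (*-cong (Π-head m f) refl) (*-assoc _ _ _)

  Π-reverse : ∀ m f → Π m f ≈ Π m (λ i → f (m ∸ suc i))
  Π-reverse zero    f = refl
  Π-reverse (suc m) f =
    trans (*-cong (Π-reverse m f) refl) (trans (*-comm _ _) (sym (Π-head m (λ i → f (m ∸ i)))))

  Π-reflect : ∀ m {f g : ℕ → Carrier} → (∀ i → i ≤ m → f (m ∸ i) ≈ g i) →
              Π (suc m) f ≈ Π (suc m) g
  Π-reflect m {f} f≈g = trans (Π-reverse (suc m) f) (Π-cong (suc m) (λ i i<1+m → f≈g i (ℕ.≤-pred i<1+m)))

  Π-+ : ∀ m n f → Π (m + n) f ≈ Π m f * Π n (λ i → f (m + i))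
  Π-+ zero    n f = sym (*-identityˡ _)
  Π-+ (suc m) n f = begin
    Π (suc (m + n)) f                                    ≈⟨ Π-head (m + n) f ⟩
    f 0 * Π (m + n) (λ i → f (suc i))                   ≈⟨ *-cong refl (Π-+ m n (λ i → f (suc i))) ⟩
    f 0 * (Π m (λ i → f (suc i)) * Π n (λ i → f (suc m + i))) ≈⟨ sym (*-assoc _ _ _) ⟩
    (f 0 * Π m (λ i → f (suc i))) * Π n (λ i → f (suc m + i)) ≈⟨ *-cong (sym (Π-head m f)) refl ⟩
    Π (suc m) f * Π n (λ i → f (suc m + i))            ∎

  Π-swapBlocks : ∀ m n f → Π m f * Π n (λ i → f (m + i)) ≈ Π m (λ i → f (n + i)) * Π n f
  Π-swapBlocks m n f = begin
    Π m f * Π n (λ i → f (m + i)) ≈⟨ sym (Π-+ m n f) ⟩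
    Π (m + n) f                   ≈⟨ reflexive (≡.cong (λ l → Π l f) (ℕ.+-comm m n)) ⟩
    Π (n + m) f                   ≈⟨ Π-+ n m f ⟩
    Π n f * Π m (λ i → f (n + i)) ≈⟨ *-comm _ _ ⟩
    Π m (λ i → f (n + i)) * Π n f ∎

  Π-* : ∀ m f g → Π m (λ i → f i * g i) ≈ Π m f * Π m g
  Π-* zero    f g = sym (*-identityˡ _)
  Π-* (suc m) f g = trans (*-cong (Π-* m f g) refl) (interchange _ _ _ _)

  sumFin-cong : ∀ n {f g : Fin n → Carrier} → (∀ i → f i ≈ g i) → sumFin R n f ≈ sumFin R n g
  sumFin-cong zero    f≈g = refl
  sumFin-cong (suc n) f≈g = +-cong (f≈g Fin.zero) (sumFin-cong n (λ i → f≈g (Fin.suc i)))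

  sumFin-*ˡ : ∀ n x (f : Fin n → Carrier) → sumFin R n (λ t → x * f t) ≈ x * sumFin R n f
  sumFin-*ˡ zero    x f = sym (zeroʳ x)
  sumFin-*ˡ (suc n) x f = trans (+-cong refl (sumFin-*ˡ n x (λ i → f (Fin.suc i)))) (sym (distribˡ x _ _))

  det-cong : ∀ n {M N : Fin n → Fin n → Carrier} → (∀ s t → M s t ≈ N s t) → det R n M ≈ det R n N
  det-cong zero    M≈N = refl
  det-cong (suc n) M≈N = sumFin-cong (suc n) λ t →
    *-cong (refl {x = signPow R (toℕ t)})
           (*-cong (M≈N Fin.zero t) (det-cong n (λ s u → M≈N (Fin.suc s) (punchIn t u))))

  det-rescale : ∀ n (u v : Fin n → Carrier) (M : Fin n → Fin n → Carrier) →
                det R n (λ s t → (u s * v t) * M s t) ≈ (prodFin u * prodFin v) * det R n M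
  det-rescale zero    u v M = sym (trans (*-identityʳ _) (*-identityˡ _))
  det-rescale (suc n) u v M =
    trans (sumFin-cong (suc n) term) (sumFin-*ˡ (suc n) _ (λ t → σ t * (M Fin.zero t * minor t)))
    where
    σ : Fin (suc n) → Carrier
    σ t = signPow R (toℕ t)
    minor : Fin (suc n) → Carrier
    minor t = det R n (λ s w → M (Fin.suc s) (punchIn t w))
    term : ∀ t →
      σ t * (((u Fin.zero * v t) * M Fin.zero t) *
             det R n (λ s w → (u (Fin.suc s) * v (punchIn t w)) * M (Fin.suc s) (punchIn t w)))
      ≈ (prodFin u * prodFin v) * (σ t * (M Fin.zero t * minor t))
    -- v t and the column factors of the minor recombine to prodFin v.
    term t = begin
      _ ≈⟨ *-cong refl (*-cong refl
             (det-rescale n (λ s → u (Fin.suc s)) (λ w → v (punchIn t w)) (λ s w → M (Fin.suc s) (punchIn t w)))) ⟩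
      _ ≈⟨ solve 7 (λ σt u₀ vt m pu pv d →
                      σt ⊕ (((u₀ ⊕ vt) ⊕ m) ⊕ ((pu ⊕ pv) ⊕ d)) ⊜ ((u₀ ⊕ pu) ⊕ (vt ⊕ pv)) ⊕ (σt ⊕ (m ⊕ d)))
                   refl (σ t) (u Fin.zero) (v t) (M Fin.zero t)
                   (prodFin (λ s → u (Fin.suc s))) (prodFin (λ w → v (punchIn t w))) (minor t) ⟩
      _ ≈⟨ *-cong (*-cong refl (sym (prodFin-remove v))) refl ⟩
      _ ∎

  IsToeplitz : Matrix R → Set ℓ
  IsToeplitz E = ∀ t x y → E (t + x) (t + y) ≈ E x y

  toeplitz-≡ : ∀ {E : Matrix R} → IsToeplitz E → ∀ t {x y x′ y′} → x′ ≡ t + x → y′ ≡ t + y → E x′ y′ ≈ E x y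
  toeplitz-≡ E-toeplitz t ≡.refl ≡.refl = E-toeplitz t _ _

  lowerToeplitz : (ℕ → Carrier) → Matrix R
  lowerToeplitz b x y with y ≤? x
  ... | yes _ = b (x ∸ y)
  ... | no  _ = 0#

  lowerToeplitz-isToeplitz : ∀ b → IsToeplitz (lowerToeplitz b)
  lowerToeplitz-isToeplitz b t x y with y ≤? x | t + y ≤? t + x
  ... | yes _   | yes _   = reflexive (≡.cong b (ℕ.[m+n]∸[m+o]≡n∸o t x y))
  ... | no  _   | no  _   = refl
  ... | yes y≤x | no  y≰x = ⊥-elim (y≰x (ℕ.+-monoʳ-≤ t y≤x))
  ... | no  y≰x | yes y≤x = ⊥-elim (y≰x (ℕ.+-cancelˡ-≤ t y x y≤x))

  compound-isToeplitz : ∀ j {T : Matrix R} → IsToeplitz T → IsToeplitz (compound R j T)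
  compound-isToeplitz j T-toeplitz t x y with y ≤? x | t + y ≤? t + x
  ... | yes _   | yes _   = det-cong j λ s u →
    toeplitz-≡ T-toeplitz t (ℕ.+-assoc t x (toℕ s)) (ℕ.+-assoc t y (toℕ u))
  ... | no  _   | no  _   = refl
  ... | yes y≤x | no  y≰x = ⊥-elim (y≰x (ℕ.+-monoʳ-≤ t y≤x))
  ... | no  y≰x | yes y≤x = ⊥-elim (y≰x (ℕ.+-cancelˡ-≤ t y x y≤x))

  windowProduct : ℕ → (ℕ → Carrier) → ℕ → Carrier
  windowProduct j γ x = prodFin (λ (s : Fin j) → γ (x + toℕ s))

  compound-rescale : ∀ j {γ α : ℕ → Carrier} {A T : Matrix R} →
    (∀ x y → A x y ≈ (γ x * α y) * T x y) →
    ∀ x y → compound R j A x y ≈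
            (windowProduct j γ x * windowProduct j α y) * compound R j T x y
  compound-rescale j A≈γαT x y with y ≤? x
  ... | yes _ = trans (det-cong j (λ s t → A≈γαT _ _)) (det-rescale j _ _ _)
  ... | no  _ = sym (zeroʳ _)

  abcMatrix-rescale : ∀ a b cc x y → abcMatrix R a b cc x y ≈ (cc x * a y) * lowerToeplitz b x y
  abcMatrix-rescale a b cc x y with y ≤? x
  ... | yes _ = xy∙z≈zx∙y _ _ _
  ... | no  _ = sym (zeroʳ _)

  regroup : ∀ {a b c d e f a′ b′ c′ d′ e′ f′} →
            a * d ≈ a′ * d′ → b * e ≈ b′ * e′ → c ≈ c′ → f ≈ f′ →
            ((a * b) * c) * ((d * e) * f) ≈ ((a′ * b′) * c′) * ((d′ * e′) * f′)
  regroup {a} {b} {c} {d} {e} {f} {a′} {b′} {c′} {d′} {e′} {f′} ad be c≈ f≈ = begin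
    ((a * b) * c) * ((d * e) * f)        ≈⟨ interchange _ _ _ _ ⟩
    ((a * b) * (d * e)) * (c * f)        ≈⟨ *-cong (interchange _ _ _ _) refl ⟩
    ((a * d) * (b * e)) * (c * f)        ≈⟨ *-cong (*-cong ad be) (*-cong c≈ f≈) ⟩
    ((a′ * d′) * (b′ * e′)) * (c′ * f′) ≈⟨ *-cong (interchange _ _ _ _) refl ⟨
    ((a′ * b′) * (d′ * e′)) * (c′ * f′) ≈⟨ interchange _ _ _ _ ⟨
    ((a′ * b′) * c′) * ((d′ * e′) * f′) ∎

  Π-rescaled : ∀ {γ α : ℕ → Carrier} {A E : Matrix R} → (∀ x y → A x y ≈ (γ x * α y) * E x y) →
    ∀ m (x y : ℕ → ℕ) →
    Π m (λ i → A (x i) (y i)) ≈ (Π m (λ i → γ (x i)) * Π m (λ i → α (y i))) * Π m (λ i → E (x i) (y i))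
  Π-rescaled {γ} {α} {A} {E} A≈γαE m x y = begin
    Π m (λ i → A (x i) (y i))                                   ≈⟨ Π-cong m (λ i _ → A≈γαE (x i) (y i)) ⟩
    Π m (λ i → (γ (x i) * α (y i)) * E (x i) (y i))           ≈⟨ Π-* m _ _ ⟩
    Π m (λ i → γ (x i) * α (y i)) * Π m (λ i → E (x i) (y i)) ≈⟨ *-cong (Π-* m _ _) refl ⟩
    (Π m (λ i → γ (x i)) * Π m (λ i → α (y i))) * Π m (λ i → E (x i) (y i)) ∎

  row-factors : ∀ (g : ℕ → Carrier) r q → let p = suc (r + q) in
    Π (suc r) g * Π (suc q) (λ i → g (p ∸ i)) ≈ Π (suc r) (λ i → g (p ∸ i)) * Π (suc q) g
  row-factors g r q = begin
    Π (suc r) g * Π (suc q) (λ i → g (suc (r + q) ∸ i))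
      ≈⟨ *-cong refl (sym (Π-reflect q λ i i≤q → reflexive
           (≡.cong g (≡.sym (ℕ.+-∸-assoc (suc r) i≤q))))) ⟩
    Π (suc r) g * Π (suc q) (λ i → g (suc r + i))            ≈⟨ Π-swapBlocks (suc r) (suc q) g ⟩
    Π (suc r) (λ i → g (suc q + i)) * Π (suc q) g
      ≈⟨ *-cong (Π-reflect r λ i i≤r → reflexive
           (≡.cong g (≡.sym ([1+m+n]∸o≡1+n+[m∸o] r q i≤r)))) refl ⟩
    Π (suc r) (λ i → g (suc (r + q) ∸ i)) * Π (suc q) g      ∎

  column-factors : ∀ (α : ℕ → Carrier) k r q →
    Π (suc r) (λ i → α (k + (r ∸ i))) * Π (suc q) (λ i → α (k + r + i + 1)) ≈
    Π (suc r) (λ i → α (k + suc q + i)) * Π (suc q) (λ i → α (k + (suc q ∸ i ∸ 1)))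
  column-factors α k r q = begin
    Π (suc r) (λ i → h (r ∸ i)) * Π (suc q) (λ i → α (k + r + i + 1))
      ≈⟨ *-cong (sym (Π-reverse (suc r) h))
                (Π-cong (suc q) λ i _ → reflexive (≡.cong α (shift k r i))) ⟩
    Π (suc r) h * Π (suc q) (λ i → h (suc r + i))              ≈⟨ Π-swapBlocks (suc r) (suc q) h ⟩
    Π (suc r) (λ i → h (suc q + i)) * Π (suc q) h
      ≈⟨ *-cong (Π-cong (suc r) λ i _ → reflexive (≡.cong α (ℕ.+-assoc k (suc q) i)))
                (sym (Π-reverse (suc q) h)) ⟨
    Π (suc r) (λ i → α (k + suc q + i)) * Π (suc q) (λ i → h (q ∸ i))
      ≈⟨ *-cong refl (Π-cong (suc q) λ i _ →
           reflexive (≡.cong (λ z → α (k + z)) ([1+m]∸n∸1≡m∸n q i))) ⟨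
    Π (suc r) (λ i → α (k + suc q + i)) * Π (suc q) (λ i → α (k + (suc q ∸ i ∸ 1))) ∎
    where
    h : ℕ → Carrier
    h i = α (k + i)
    shift : ∀ k r i → k + r + i + 1 ≡ k + (suc r + i)
    shift = solve-∀

  module _ {E : Matrix R} (E-toeplitz : IsToeplitz E) where

    toeplitz-factors₁ : ∀ n k r q → let p = suc (r + q) in
      Π (suc r) (λ i → E (n + i) (k + (r ∸ i))) ≈ Π (suc r) (λ i → E (n + (p ∸ i)) (k + suc q + i))
    toeplitz-factors₁ n k r q = sym (Π-reflect r λ i i≤r →
      toeplitz-≡ E-toeplitz (suc q)
        (≡.trans (≡.cong (n +_) ([1+m+n]∸[m∸o]≡1+n+o r q i≤r)) (shift n (suc q) i))
        (≡.trans (ℕ.+-assoc k (suc q) (r ∸ i)) (shift k (suc q) (r ∸ i))))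
      where
      shift : ∀ n t i → n + (t + i) ≡ t + (n + i)
      shift = solve-∀

    toeplitz-factors₂ : ∀ n k r q → let p = suc (r + q) in
      Π (suc q) (λ i → E (n + (p ∸ i)) (k + r + i + 1)) ≈
      Π (suc q) (λ i → E (n + i) (k + (suc q ∸ i ∸ 1)))
    toeplitz-factors₂ n k r q = Π-reflect q λ i i≤q →
      toeplitz-≡ E-toeplitz (suc r)
        (≡.trans (≡.cong (n +_) ([1+m+n]∸[n∸o]≡1+m+o r q i≤q)) (shift-row n r i))
        (≡.trans (shift-column k r (q ∸ i)) (≡.cong (λ z → suc r + (k + z)) (≡.sym ([1+m]∸n∸1≡m∸n q i))))
      where
      shift-row : ∀ n r i → n + (suc r + i) ≡ suc r + (n + i)
      shift-row = solve-∀
      shift-column : ∀ k r j → k + r + j + 1 ≡ suc r + (k + j)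
      shift-column = solve-∀

    -- d stands for p ∸ r; abstracting it lets the SDR goal be matched without normalising it.
    sdr-identity : ∀ {γ α : ℕ → Carrier} {A : Matrix R} → (∀ x y → A x y ≈ (γ x * α y) * E x y) →
      ∀ n k r q d → d ≡ suc q → let p = suc (r + q) in
      Π (suc r) (λ i → A (n + i) (k + (r ∸ i))) * Π d (λ i → A (n + (p ∸ i)) (k + r + i + 1)) ≈
      Π (suc r) (λ i → A (n + (p ∸ i)) (k + d + i)) * Π d (λ i → A (n + i) (k + (d ∸ i ∸ 1)))
    sdr-identity {γ} {α} A≈γαE n k r q _ ≡.refl =
      trans (*-cong (Π-rescaled A≈γαE (suc r) (n +_) (λ i → k + (r ∸ i)))
                    (Π-rescaled A≈γαE (suc q) (λ i → n + (suc (r + q) ∸ i)) (λ i → k + r + i + 1)))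
        (trans (regroup (row-factors (λ i → γ (n + i)) r q) (column-factors α k r q)
                        (toeplitz-factors₁ n k r q) (toeplitz-factors₂ n k r q))
               (sym (*-cong (Π-rescaled A≈γαE (suc r) (λ i → n + (suc (r + q) ∸ i)) (λ i → k + suc q + i))
                            (Π-rescaled A≈γαE (suc q) (n +_) (λ i → k + (suc q ∸ i ∸ 1))))))

    rescaledToeplitz-SDR : ∀ {γ α : ℕ → Carrier} {A : Matrix R} →
      (∀ x y → A x y ≈ (γ x * α y) * E x y) → ∀ m → SDR R m A
    rescaledToeplitz-SDR A≈γαE m n k zero    r () _ _
    rescaledToeplitz-SDR A≈γαE m n k (suc p) r _ _ r≤p with ℕ.m≤n⇒∃[o]m+o≡n r≤p
    ... | q , ≡.refl = sdr-identity A≈γαE n k r q _ ([1+m+n]∸m≡1+n r q)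

theorem2p4 : {c ℓ : Level} (R : CommutativeRing c ℓ) →
    (a b cc : ℕ → CommutativeRing.Carrier R) →
    CommutativeRing._≈_ R (b 0) (CommutativeRing.1# R) →
    (∀ n → ¬ CommutativeRing._≈_ R (a n) (CommutativeRing.0# R)) →
    (∀ n → ¬ CommutativeRing._≈_ R (cc n) (CommutativeRing.0# R)) →
    (j : ℕ) → 1 ≤ j →
    SDR∞ R (compound R j (abcMatrix R a b cc))
theorem2p4 R a b cc _ _ _ j _ m _ =
  rescaledToeplitz-SDR R (compound-isToeplitz R j (lowerToeplitz-isToeplitz R b))
    (compound-rescale R j (abcMatrix-rescale R a b cc)) m
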